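{- Let $G_1,G_2$ be connected graphs with $G_1\subseteq G_2$ and $\chi(G_2)\geq 3$. Then: (i) $R_2(\mathscr{C}(G_1\cup G_2))\leq R_2(G_2)+\chi(G_2)|V(G_2)|$; (ii) if $\chi(G_1)<\chi(G_2)$, then $R_2(\mathscr{C}(G_1\cup G_2))\leq R_2(G_2)+(\chi(G_2)-1)|V(G_2)|$.
   Context: $\cup$ is vertex-disjoint union; $\subseteq$ is subgraph; $\chi$ is chromatic number. For a disconnected graph $H$, $\mathscr{C}(H)$ is the set of all connected graphs containing $H$ as a (not necessarily spanning or induced) subgraph. $R_2(G)$ is the minimum $n$ such that every $2$-edge-coloring of $K_n$ contains a monochromatic $G$; for a family $\mathscr{H}$, $R_2(\mathscr{H})$ is the minimum $n$ such that every $2$-edge-coloring of $K_n$ contains a monochromatic copy of some member of $\mathscr{H}$. -}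

module Defs where

open import Data.Nat using (ℕ; zero; suc; _+_; _*_; _≤_; _<_)
open import Data.Fin using (Fin; splitAt)
open import Data.Bool using (Bool; true; false)
open import Data.Sum using (_⊎_; inj₁; inj₂)
open import Data.Product using (Σ; ∃; _×_; _,_)
open import Relation.Binary.PropositionalEquality using (_≡_; _≢_)
open import Relation.Nullary using (¬_)
open import Function.Definitions using (Injective)

record Graph : Set where
  field
    vsize : ℕ
    Adj   : Fin vsize → Fin vsize → Bool
    sym   : ∀ u v → Adj u v ≡ Adj v u
    irr   : ∀ u → Adj u u ≡ false
open Graph public

∣V∣ : Graph → ℕ
∣V∣ G = vsize G

data Reach (G : Graph) : Fin (vsize G) → Fin (vsize G) → Set where
  here : ∀ {u} → Reach G u u
  step : ∀ {u v w} → Adj G u v ≡ true → Reach G v w → Reach G u w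

Connected : Graph → Set
Connected G = (0 < vsize G) × (∀ u v → Reach G u v)

-- H ⊆ G: an injective vertex map preserving edges (not nec. induced/spanning).
_⊆G_ : Graph → Graph → Set
H ⊆G G = Σ (Fin (vsize H) → Fin (vsize G)) λ f →
           Injective _≡_ _≡_ f × (∀ u v → Adj H u v ≡ true → Adj G (f u) (f v) ≡ true)

-- Vertex-disjoint union.
unionAdj : ∀ {m n} → (Fin m → Fin m → Bool) → (Fin n → Fin n → Bool)
         → Fin (m + n) → Fin (m + n) → Bool
unionAdj {m} A B x y with splitAt m x | splitAt m y
... | inj₁ a | inj₁ b = A a b
... | inj₂ a | inj₂ b = B a b
... | inj₁ _ | inj₂ _ = false
... | inj₂ _ | inj₁ _ = false

unionSym : ∀ {m n} (A : Fin m → Fin m → Bool) (B : Fin n → Fin n → Bool)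
         → (∀ u v → A u v ≡ A v u) → (∀ u v → B u v ≡ B v u)
         → ∀ x y → unionAdj A B x y ≡ unionAdj A B y x
unionSym {m} A B sA sB x y with splitAt m x | splitAt m y
... | inj₁ a | inj₁ b = sA a b
... | inj₂ a | inj₂ b = sB a b
... | inj₁ _ | inj₂ _ = Relation.Binary.PropositionalEquality.refl
... | inj₂ _ | inj₁ _ = Relation.Binary.PropositionalEquality.refl

unionIrr : ∀ {m n} (A : Fin m → Fin m → Bool) (B : Fin n → Fin n → Bool)
         → (∀ u → A u u ≡ false) → (∀ u → B u u ≡ false)
         → ∀ x → unionAdj A B x x ≡ false
unionIrr {m} A B iA iB x with splitAt m x
... | inj₁ a = iA a
... | inj₂ a = iB a

_∪G_ : Graph → Graph → Graph
G ∪G H = record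
  { vsize = vsize G + vsize H
  ; Adj   = unionAdj (Adj G) (Adj H)
  ; sym   = unionSym (Adj G) (Adj H) (sym G) (sym H)
  ; irr   = unionIrr (Adj G) (Adj H) (irr G) (irr H)
  }

Colorable : Graph → ℕ → Set
Colorable G k = Σ (Fin (vsize G) → Fin k) λ c →
                  ∀ u v → Adj G u v ≡ true → c u ≢ c v

IsChromaticNumber : Graph → ℕ → Set
IsChromaticNumber G k = Colorable G k × (∀ j → j < k → ¬ Colorable G j)

-- 2-edge-colourings of K_N (symmetric colour function on pairs; the
-- diagonal value is irrelevant since graphs are loopless).
EdgeColoring2 : ℕ → Set
EdgeColoring2 N = Σ (Fin N → Fin N → Bool) λ c → ∀ x y → c x y ≡ c y x

MonoCopy : ∀ {N} → (Fin N → Fin N → Bool) → Bool → Graph → Set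
MonoCopy {N} c b F = Σ (Fin (vsize F) → Fin N) λ f →
  Injective _≡_ _≡_ f × (∀ u v → Adj F u v ≡ true → c (f u) (f v) ≡ b)

Family : Set₁
Family = Graph → Set

Arrows : ℕ → Family → Set
Arrows N 𝓗 = (c : EdgeColoring2 N) →
  ∃ λ b → ∃ λ F → 𝓗 F × MonoCopy (Data.Product.proj₁ c) b F

-- the singleton family {G} (up to isomorphism, copies are what count)
single : Graph → Family
single G F = F ≡ G

IsRamsey : Family → ℕ → Set
IsRamsey 𝓗 n = Arrows n 𝓗 × (∀ m → m < n → ¬ Arrows m 𝓗)

-- R₂(𝓗) ≤ N, read literally as "some m ≤ N is arrowing" (the minimum exists).
RamseyLE : Family → ℕ → Set
RamseyLE 𝓗 N = ∃ λ m → m ≤ N × Arrows m 𝓗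

𝒞 : Graph → Family
𝒞 H F = Connected F × (H ⊆G F)

-- Let G₁ be p-colourable and G₂ (p+1)-colourable with p ≥ 1, and 2-colour K_N with
-- N = r + p|V(G₂)|. As any r vertices span a monochromatic G₂, p+1 vertex-disjoint
-- monochromatic copies of G₂ can be picked greedily, and some colour b has a connected colour
-- class. If two copies have colour b, G₁ ∪ G₂ sits in them, inside that connected class. If two
-- copies of colour ¬b are joined by a ¬b edge, the ¬b graph on these two copies is connected and
-- contains G₁ ∪ G₂. Otherwise every edge between two different ¬b copies has colour b, so a graph
-- with a proper colouring κ and an injection ψ into V(G₂) embeds in colour b by sending w to
-- vertex ψ w of the copy numbered κ w. With one b copy, G₂ lies in it and G₁ is spread over the
-- other p copies; with none, G₂ is spread by a (p+1)-colouring κ and G₁ by κ followed by a cyclic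
-- shift, so that the two images are disjoint. Both bounds are instances: p = χ(G₂), and
-- p = χ(G₂) − 1 ≥ χ(G₁).
module Submission where

open import Defs
open import Data.Nat using (ℕ; zero; suc; _+_; _*_; _∸_; _≤_; _<_; z≤n; s≤s; s≤s⁻¹; >-nonZero⁻¹)
open import Data.Nat.Properties
  using (≤-refl; ≤-trans; ≤-reflexive; m≤m+n; n≤1+n; 1+n≢n; +-commutativeSemigroup)
open import Algebra.Properties.CommutativeSemigroup +-commutativeSemigroup using (x∙yz≈y∙xz)
open import Data.Fin
  using ( Fin; zero; suc; toℕ; splitAt; _↑ˡ_; _↑ʳ_; inject≤; inject₁; fromℕ; fromℕ<
        ; punchIn; punchOut; _≟_)
open import Data.Fin.Properties
  using ( ↑ˡ-injective; ↑ʳ-injective; splitAt-↑ˡ; splitAt-↑ʳ; splitAt⁻¹-↑ˡ; splitAt⁻¹-↑ʳ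
        ; inject≤-injective; inject₁-injective; fromℕ≢inject₁; toℕ-inject₁; suc-injective
        ; punchIn-injective; punchInᵢ≢i; punchOut-injective; punchIn-punchOut; any?; nonZeroIndex)
open import Data.Bool using (Bool; true; not; _∧_)
open import Data.Bool.Properties using (¬-not; not-involutive; ∧-zeroʳ) renaming (_≟_ to _≟ᵇ_)
open import Data.Vec.Functional using (_++_)
open import Data.Vec.Functional.Properties using (lookup-++ˡ; lookup-++ʳ)
open import Data.Sum using (_⊎_; inj₁; inj₂)
open import Data.Product using (Σ; ∃; ∃₂; _×_; _,_; proj₁; proj₂)
open import Function using (id; _∘_; mk⇔)
open import Function.Definitions using (Injective)
open import Relation.Binary.PropositionalEquality as ≡ using (_≡_; _≢_; refl; cong; cong₂; subst; trans)
open import Relation.Nullary using (yes; no; does; ¬?; _×-dec_; contradiction)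
open import Relation.Nullary.Decidable using (dec-true; dec-false; does-⇔)

reach-trans : ∀ {G u v w} → Reach G u v → Reach G v w → Reach G u w
reach-trans here        q = q
reach-trans (step e p) q = step e (reach-trans p q)

reach-sym : ∀ {G u v} → Reach G u v → Reach G v u
reach-sym here                   = here
reach-sym {G} (step {u} {v} e p) = reach-trans (reach-sym p) (step (trans (sym G v u) e) here)

reach-⊆ : ∀ {H G} (H⊆G : H ⊆G G) {u v} → Reach H u v → Reach G (proj₁ H⊆G u) (proj₁ H⊆G v)
reach-⊆ H⊆G here       = here
reach-⊆ H⊆G (step e p) = step (proj₂ (proj₂ H⊆G) _ _ e) (reach-⊆ H⊆G p)

rooted⇒connected : ∀ {G} (x₀ : Fin (vsize G)) → (∀ x → Reach G x x₀) → ∀ u v → Reach G u v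
rooted⇒connected x₀ toRoot u v = reach-trans (toRoot u) (reach-sym (toRoot v))

complement-injection : ∀ {n M N} (h : Fin n → Fin N) → Injective _≡_ _≡_ h → n + M ≤ N →
  Σ (Fin M → Fin N) λ e → Injective _≡_ _≡_ e × (∀ x u → e x ≢ h u)
complement-injection {zero} h _ M≤N = (λ x → inject≤ x M≤N) , inject≤-injective M≤N M≤N _ _ , λ _ ()
complement-injection {suc n} {N = suc N} h h-inj n+M<N =
  let (e , e-inj , e∉h′) = complement-injection h′ h′-inj (s≤s⁻¹ n+M<N) in
  punchIn (h zero) ∘ e , e-inj ∘ punchIn-injective (h zero) _ _ , e∉h e e∉h′
  where
  h₀≢h : ∀ u → h zero ≢ h (suc u)
  h₀≢h u eq with () ← h-inj eq
  h′ : Fin n → Fin N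
  h′ u = punchOut (h₀≢h u)
  h′-inj : Injective _≡_ _≡_ h′
  h′-inj eq = suc-injective (h-inj (punchOut-injective (h₀≢h _) (h₀≢h _) eq))
  e∉h : ∀ {M} (e : Fin M → Fin N) → (∀ x u → e x ≢ h′ u) → ∀ x u → punchIn (h zero) (e x) ≢ h u
  e∉h e e∉h′ x zero    = punchInᵢ≢i (h zero) (e x)
  e∉h e e∉h′ x (suc u) eq =
    e∉h′ x u (punchIn-injective (h zero) _ _ (trans eq (≡.sym (punchIn-punchOut (h₀≢h u)))))

cyclicPred : ∀ {n} → Fin (suc n) → Fin (suc n)
cyclicPred zero    = fromℕ _
cyclicPred (suc i) = inject₁ i

cyclicPred-injective : ∀ {n} → Injective _≡_ _≡_ (cyclicPred {n})
cyclicPred-injective {x = zero}  {zero}  _  = refl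
cyclicPred-injective {x = zero}  {suc j} eq = contradiction eq fromℕ≢inject₁
cyclicPred-injective {x = suc i} {zero}  eq = contradiction (≡.sym eq) fromℕ≢inject₁
cyclicPred-injective {x = suc i} {suc j} eq = cong suc (inject₁-injective eq)

cyclicPred-≢ : ∀ {n} (i : Fin (suc (suc n))) → cyclicPred i ≢ i
cyclicPred-≢ zero    ()
cyclicPred-≢ (suc i) eq = 1+n≢n (trans (≡.sym (cong toℕ eq)) (toℕ-inject₁ i))

++-injective : ∀ {m n N} {f : Fin m → Fin N} {g : Fin n → Fin N} →
  Injective _≡_ _≡_ f → Injective _≡_ _≡_ g → (∀ u v → f u ≢ g v) → Injective _≡_ _≡_ (f ++ g)
++-injective {m} f-inj g-inj f∉g {x} {y} eq with splitAt m x in ex | splitAt m y in ey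
... | inj₁ u | inj₁ v =
  trans (≡.sym (splitAt⁻¹-↑ˡ ex)) (trans (cong (_↑ˡ _) (f-inj eq)) (splitAt⁻¹-↑ˡ ey))
... | inj₂ u | inj₂ v =
  trans (≡.sym (splitAt⁻¹-↑ʳ ex)) (trans (cong (m ↑ʳ_) (g-inj eq)) (splitAt⁻¹-↑ʳ ey))
... | inj₁ u | inj₂ v = contradiction eq (f∉g u v)
... | inj₂ u | inj₁ v = contradiction (≡.sym eq) (f∉g v u)

↑ˡ≢↑ʳ : ∀ m {n} (u : Fin m) (v : Fin n) → u ↑ˡ n ≢ m ↑ʳ v
↑ˡ≢↑ʳ m {n} u v eq
  with () ← trans (≡.sym (splitAt-↑ˡ m u n)) (trans (cong (splitAt m) eq) (splitAt-↑ʳ m n v))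

adj⇒≢ : ∀ {G u v} → Adj G u v ≡ true → u ≢ v
adj⇒≢ {G} {u} uv refl with () ← trans (≡.sym uv) (irr G u)

-- H ⊆G F is by definition MonoCopy (Adj F) true H, so the MonoCopy lemmas apply to subgraphs.
monoCopy-⊆ : ∀ {H F N} {c : Fin N → Fin N → Bool} {b} → H ⊆G F → MonoCopy c b F → MonoCopy c b H
monoCopy-⊆ (f , f-inj , f-adj) (g , g-inj , g-mono) =
  g ∘ f , f-inj ∘ g-inj , λ u v uv → g-mono (f u) (f v) (f-adj u v uv)

monoCopy-∪ : ∀ {A B N} {c : Fin N → Fin N → Bool} {b} (f : MonoCopy c b A) (g : MonoCopy c b B) →
  (∀ u v → proj₁ f u ≢ proj₁ g v) → MonoCopy c b (A ∪G B)
monoCopy-∪ {A} {B} {c = c} {b} (f , f-inj , f-mono) (g , g-inj , g-mono) f∉g =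
  f ++ g , ++-injective f-inj g-inj f∉g , mono
  where
  mono : ∀ x y → Adj (A ∪G B) x y ≡ true → c ((f ++ g) x) ((f ++ g) y) ≡ b
  mono x y xy with splitAt (vsize A) x | splitAt (vsize A) y
  mono x y xy | inj₁ u | inj₁ v = f-mono u v xy
  mono x y xy | inj₂ u | inj₂ v = g-mono u v xy
  mono x y () | inj₁ _ | inj₂ _
  mono x y () | inj₂ _ | inj₁ _

⊆-refl : ∀ {G} → G ⊆G G
⊆-refl = id , id , λ _ _ uv → uv

⊆-trans : ∀ {A B C} → A ⊆G B → B ⊆G C → A ⊆G C
⊆-trans {A} {B} {C} = monoCopy-⊆ {A} {B} {c = Adj C}

⊆-∪ˡ : ∀ A B → A ⊆G (A ∪G B)
⊆-∪ˡ A B = _↑ˡ vsize B , ↑ˡ-injective (vsize B) _ _ , adj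
  where
  adj : ∀ u v → Adj A u v ≡ true → Adj (A ∪G B) (u ↑ˡ vsize B) (v ↑ˡ vsize B) ≡ true
  adj u v uv rewrite splitAt-↑ˡ (vsize A) u (vsize B) | splitAt-↑ˡ (vsize A) v (vsize B) = uv

⊆-∪ʳ : ∀ A B → B ⊆G (A ∪G B)
⊆-∪ʳ A B = vsize A ↑ʳ_ , ↑ʳ-injective (vsize A) _ _ , adj
  where
  adj : ∀ u v → Adj B u v ≡ true → Adj (A ∪G B) (vsize A ↑ʳ u) (vsize A ↑ʳ v) ≡ true
  adj u v uv rewrite splitAt-↑ʳ (vsize A) (vsize B) u | splitAt-↑ʳ (vsize A) (vsize B) v = uv

∪-mono-⊆ : ∀ {A A′ B B′} → A ⊆G A′ → B ⊆G B′ → (A ∪G B) ⊆G (A′ ∪G B′)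
∪-mono-⊆ {A} {A′} {B} {B′} A⊆A′ B⊆B′ =
  monoCopy-∪ {A} {B} {c = Adj (A′ ∪G B′)}
    (⊆-trans {A} {A′} {A′ ∪G B′} A⊆A′ (⊆-∪ˡ A′ B′)) (⊆-trans {B} {B′} {A′ ∪G B′} B⊆B′ (⊆-∪ʳ A′ B′))
    λ _ _ → ↑ˡ≢↑ʳ (vsize A′) _ _

monoCopy-lift : ∀ {H M N} {c : Fin N → Fin N → Bool} {b} {e : Fin M → Fin N} → Injective _≡_ _≡_ e →
  MonoCopy (λ x y → c (e x) (e y)) b H → MonoCopy c b H
monoCopy-lift {e = e} e-inj (f , f-inj , f-mono) = e ∘ f , f-inj ∘ e-inj , f-mono

restrict : ∀ {M N} → EdgeColoring2 N → (Fin M → Fin N) → EdgeColoring2 M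
restrict (c , c-sym) e = (λ x y → c (e x) (e y)) , λ x y → c-sym (e x) (e y)

colourGraph : ∀ {N} → EdgeColoring2 N → Bool → Graph
colourGraph {N} (c , c-sym) b = record
  { vsize = N
  ; Adj   = λ x y → not (does (x ≟ y)) ∧ does (c x y ≟ᵇ b)
  ; sym   = λ x y → cong₂ (λ p q → not p ∧ does (q ≟ᵇ b))
                          (does-⇔ (mk⇔ ≡.sym ≡.sym) (x ≟ y) (y ≟ x)) (c-sym x y)
  ; irr   = λ x → cong (λ p → not p ∧ does (c x x ≟ᵇ b)) (dec-true (x ≟ x) refl)
  }

module _ {N} (c : EdgeColoring2 N) (b : Bool) where

  colourGraph-adj : ∀ x y → x ≢ y → proj₁ c x y ≡ b → Adj (colourGraph c b) x y ≡ true
  colourGraph-adj x y x≢y cxy rewrite dec-false (x ≟ y) x≢y | dec-true (proj₁ c x y ≟ᵇ b) cxy = refl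

  colourGraph-colour : ∀ {x y} → Adj (colourGraph c b) x y ≡ true → proj₁ c x y ≡ b
  colourGraph-colour {x} {y} xy with proj₁ c x y ≟ᵇ b
  ... | yes cxy = cxy
  ... | no _ with () ← trans (≡.sym (∧-zeroʳ _)) xy

  colourGraph-monoCopy : MonoCopy (proj₁ c) b (colourGraph c b)
  colourGraph-monoCopy = id , id , λ _ _ → colourGraph-colour

  monoCopy⇒⊆colourGraph : ∀ {H} → MonoCopy (proj₁ c) b H → H ⊆G colourGraph c b
  monoCopy⇒⊆colourGraph {H} (f , f-inj , f-mono) =
    f , f-inj , λ u v uv → colourGraph-adj (f u) (f v) (adj⇒≢ {H} uv ∘ f-inj) (f-mono u v uv)

colourGraph-restrict-⊆ : ∀ {M N} (c : EdgeColoring2 N) (b : Bool) {e : Fin M → Fin N} →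
  Injective _≡_ _≡_ e → colourGraph (restrict c e) b ⊆G colourGraph c b
colourGraph-restrict-⊆ c b {e} e-inj = monoCopy⇒⊆colourGraph c b {colourGraph (restrict c e) b}
  (monoCopy-lift {colourGraph (restrict c e) b} {c = proj₁ c} e-inj
                 (colourGraph-monoCopy (restrict c e) b))

monoCopy-restrict : ∀ {H N} {c : EdgeColoring2 N} {b} (M : MonoCopy (proj₁ c) b H) →
  MonoCopy (proj₁ (restrict c (proj₁ M))) b H
monoCopy-restrict (_ , _ , mono) = id , id , mono

-- Either vertex 0 has a b-edge into the rest, whose b-graph is connected by induction, or
-- all its edges have colour ¬b and it is the centre of a spanning ¬b star.
colourGraph-connected : ∀ {N} (c : EdgeColoring2 N) → 0 < N → ∃ λ b → Connected (colourGraph c b)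
colourGraph-connected {suc zero} c _ = true , s≤s z≤n , λ { zero zero → here }
colourGraph-connected {suc (suc N)} c _ with colourGraph-connected (restrict c suc) (s≤s z≤n)
... | b , _ , conn with any? (λ y → proj₁ c (suc y) zero ≟ᵇ b)
...   | yes (y₀ , cy₀) = b , s≤s z≤n , rooted⇒connected zero toZero
  where
  toZero : ∀ x → Reach (colourGraph c b) x zero
  toZero zero    = here
  toZero (suc x) = reach-trans (reach-⊆ (colourGraph-restrict-⊆ c b suc-injective) (conn x y₀))
                               (step (colourGraph-adj c b (suc y₀) zero (λ ()) cy₀) here)
...   | no ∄y = not b , s≤s z≤n , rooted⇒connected zero toZero
  where
  toZero : ∀ x → Reach (colourGraph c (not b)) x zero
  toZero zero    = here
  toZero (suc x) = step (colourGraph-adj c (not b) (suc x) zero (λ ()) (¬-not (∄y ∘ (x ,_)))) here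

bridged-connected : ∀ (A B : Graph) (c : EdgeColoring2 (vsize A + vsize B)) {b} →
  Connected A → Connected B → (∀ x y → Adj (A ∪G B) x y ≡ true → proj₁ c x y ≡ b) →
  ∀ u v → proj₁ c (u ↑ˡ vsize B) (vsize A ↑ʳ v) ≡ b → Connected (colourGraph c b)
bridged-connected A B c {b} (A>0 , A-conn) (_ , B-conn) mono u₀ v₀ bridge =
  ≤-trans A>0 (m≤m+n _ _) , rooted⇒connected (u₀ ↑ˡ vsize B) toRoot
  where
  F = colourGraph c b
  A∪B⊆F : (A ∪G B) ⊆G F
  A∪B⊆F = monoCopy⇒⊆colourGraph c b {A ∪G B} (id , id , mono)
  bridge′ : Adj F (vsize A ↑ʳ v₀) (u₀ ↑ˡ vsize B) ≡ true
  bridge′ = colourGraph-adj c b _ _ (↑ˡ≢↑ʳ _ u₀ v₀ ∘ ≡.sym) (trans (proj₂ c _ _) bridge)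
  toRoot : ∀ x → Reach F x (u₀ ↑ˡ vsize B)
  toRoot x with splitAt (vsize A) x in eq
  ... | inj₁ u = subst (λ x → Reach F x _) (splitAt⁻¹-↑ˡ eq)
                   (reach-⊆ (⊆-trans {A} {A ∪G B} {F} (⊆-∪ˡ A B) A∪B⊆F) (A-conn u u₀))
  ... | inj₂ v = subst (λ x → Reach F x _) (splitAt⁻¹-↑ʳ eq)
                   (reach-trans (reach-⊆ (⊆-trans {B} {A ∪G B} {F} (⊆-∪ʳ A B) A∪B⊆F) (B-conn v v₀))
                                (step bridge′ here))

MonoMember : ∀ {N} → Family → EdgeColoring2 N → Set
MonoMember 𝓗 c = ∃ λ b → ∃ λ F → 𝓗 F × MonoCopy (proj₁ c) b F

monoMember-lift : ∀ {𝓗 M N} {c : EdgeColoring2 N} {e : Fin M → Fin N} → Injective _≡_ _≡_ e →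
  MonoMember 𝓗 (restrict c e) → MonoMember 𝓗 c
monoMember-lift {c = c} {e} e-inj (b , F , F∈𝓗 , M) =
  b , F , F∈𝓗 , monoCopy-lift {F} {c = proj₁ c} {e = e} e-inj M

Arrows-mono : ∀ {𝓗 m n} → m ≤ n → Arrows m 𝓗 → Arrows n 𝓗
Arrows-mono m≤n K_m→𝓗 c =
  monoMember-lift {c = c} (inject≤-injective m≤n m≤n _ _) (K_m→𝓗 (restrict c λ i → inject≤ i m≤n))

colourGraph-member : ∀ {N H} {c : EdgeColoring2 N} {b} →
  Connected (colourGraph c b) → MonoCopy (proj₁ c) b H → MonoMember (𝒞 H) c
colourGraph-member {H = H} {c} {b} conn M =
  b , colourGraph c b , (conn , monoCopy⇒⊆colourGraph c b {H} M) , colourGraph-monoCopy c b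

Colorable-map : ∀ {G j k} (σ : Fin j → Fin k) → Injective _≡_ _≡_ σ → Colorable G j → Colorable G k
Colorable-map σ σ-inj (κ , proper) = σ ∘ κ , λ u v uv → proper u v uv ∘ σ-inj

Colorable-mono : ∀ {G j k} → j ≤ k → Colorable G j → Colorable G k
Colorable-mono {G} j≤k = Colorable-map {G} (λ i → inject≤ i j≤k) (inject≤-injective j≤k j≤k _ _)

Colorable-⊆ : ∀ {H G k} → H ⊆G G → Colorable G k → Colorable H k
Colorable-⊆ (φ , _ , φ-adj) (κ , proper) = κ ∘ φ , λ u v uv → proper (φ u) (φ v) (φ-adj u v uv)

record DisjointMonoCopies (G : Graph) {N} (c : Fin N → Fin N → Bool) (p : ℕ) : Set where
  field
    copy           : Fin p → Fin (vsize G) → Fin N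
    colour         : Fin p → Bool
    copy-mono      : ∀ i u v → Adj G u v ≡ true → c (copy i u) (copy i v) ≡ colour i
    copy-injective : ∀ {i j u v} → copy i u ≡ copy j v → i ≡ j × u ≡ v

  copy-disjoint : ∀ {i j} → i ≢ j → ∀ u v → copy i u ≢ copy j v
  copy-disjoint i≢j u v = i≢j ∘ proj₁ ∘ copy-injective

  copy-monoCopy : ∀ {b} i → colour i ≡ b → MonoCopy c b G
  copy-monoCopy i ci = copy i , proj₂ ∘ copy-injective , λ u v uv → trans (copy-mono i u v uv) ci

  CrossColoured : ∀ {t} → (Fin t → Fin p) → Bool → Set
  CrossColoured σ b = ∀ {i j} → i ≢ j → ∀ u v → c (copy (σ i) u) (copy (σ j) v) ≡ b

  crossColoured? : ∀ {t} (σ : Fin t → Fin p) b →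
    CrossColoured σ b ⊎ ∃₂ λ i j → i ≢ j × ∃₂ λ u v → c (copy (σ i) u) (copy (σ j) v) ≡ not b
  crossColoured? σ b with any? (λ i → any? λ j → ¬? (i ≟ j) ×-dec
                           any? λ u → any? λ v → c (copy (σ i) u) (copy (σ j) v) ≟ᵇ not b)
  ... | yes (i , j , i≢j , u , v , cuv) = inj₂ (i , j , i≢j , u , v , cuv)
  ... | no ∄ = inj₁ λ {i} {j} i≢j u v →
                 trans (¬-not λ cuv → ∄ (i , j , i≢j , u , v , cuv)) (not-involutive b)

  spread : ∀ {t b H} (σ : Fin t → Fin p) → CrossColoured σ b → Colorable H t →
    (ψ : Fin (vsize H) → Fin (vsize G)) → Injective _≡_ _≡_ ψ → MonoCopy c b H
  spread σ cross (κ , proper) ψ ψ-inj =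
    (λ w → copy (σ (κ w)) (ψ w)) , ψ-inj ∘ proj₂ ∘ copy-injective ,
    λ u v uv → cross (proper u v uv) (ψ u) (ψ v)

noCopies : ∀ {G N} {c : Fin N → Fin N → Bool} → DisjointMonoCopies G c 0
noCopies = record { copy = λ () ; colour = λ () ; copy-mono = λ () ; copy-injective = λ { {()} } }

consCopies : ∀ {G N p} {c : Fin N → Fin N → Bool} {b}
  (M : MonoCopy c b G) (copies : DisjointMonoCopies G c p) →
  (∀ i u v → DisjointMonoCopies.copy copies i u ≢ proj₁ M v) → DisjointMonoCopies G c (suc p)
consCopies {G} {N} {p} {c} {b} (h , h-inj , h-mono) copies disjoint = record
  { copy = copy′ ; colour = colour′ ; copy-mono = copy-mono′ ; copy-injective = copy-injective′ }
  where
  open DisjointMonoCopies copies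
  copy′ : Fin (suc p) → Fin (vsize G) → Fin N
  copy′ zero    = h
  copy′ (suc i) = copy i
  colour′ : Fin (suc p) → Bool
  colour′ zero    = b
  colour′ (suc i) = colour i
  copy-mono′ : ∀ i u v → Adj G u v ≡ true → c (copy′ i u) (copy′ i v) ≡ colour′ i
  copy-mono′ zero    = h-mono
  copy-mono′ (suc i) = copy-mono i
  copy-injective′ : ∀ {i j u v} → copy′ i u ≡ copy′ j v → i ≡ j × u ≡ v
  copy-injective′ {zero}  {zero}          eq = refl , h-inj eq
  copy-injective′ {zero}  {suc j} {u} {v} eq = contradiction (≡.sym eq) (disjoint j v u)
  copy-injective′ {suc i} {zero}  {u} {v} eq = contradiction eq (disjoint i u v)
  copy-injective′ {suc i} {suc j}         eq =
    let (i≡j , u≡v) = copy-injective eq in cong suc i≡j , u≡v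

liftCopies : ∀ {G M N p} {c : Fin N → Fin N → Bool} {e : Fin M → Fin N} → Injective _≡_ _≡_ e →
  DisjointMonoCopies G (λ x y → c (e x) (e y)) p → DisjointMonoCopies G c p
liftCopies {e = e} e-inj copies = record
  { copy           = λ i → e ∘ copy i
  ; colour         = colour
  ; copy-mono      = copy-mono
  ; copy-injective = copy-injective ∘ e-inj
  }
  where open DisjointMonoCopies copies

arrows-monoCopy : ∀ {G r N} → Arrows r (single G) → r ≤ N →
  (c : EdgeColoring2 N) → ∃ λ b → MonoCopy (proj₁ c) b G
arrows-monoCopy K_r→G r≤N c with Arrows-mono r≤N K_r→G c
... | b , _ , refl , M = b , M

disjointMonoCopies : ∀ {G r} → Arrows r (single G) → ∀ j {N} → r + j * vsize G ≤ N →
  (c : EdgeColoring2 N) → DisjointMonoCopies G (proj₁ c) (suc j)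
disjointMonoCopies {r = r} K_r→G j le c with arrows-monoCopy K_r→G (≤-trans (m≤m+n r _) le) c
disjointMonoCopies K_r→G zero le c | _ , M = consCopies M noCopies λ ()
disjointMonoCopies {G} {r} K_r→G (suc j) le c | _ , M@(h , h-inj , _) =
  let n+[r+jn]≤N = ≤-trans (≤-reflexive (x∙yz≈y∙xz (vsize G) r _)) le
      (e , e-inj , e∉h) = complement-injection h h-inj n+[r+jn]≤N
      others = disjointMonoCopies K_r→G j ≤-refl (restrict c e)
  in consCopies M (liftCopies e-inj others) λ i u v → e∉h _ v

module _ (G₁ G₂ : Graph) (G₁⊆G₂ : G₁ ⊆G G₂) (G₂-conn : Connected G₂) {N} (c : EdgeColoring2 N) {q}
         (copies : DisjointMonoCopies G₂ (proj₁ c) (suc (suc q))) where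

  open DisjointMonoCopies copies
  private
    φ = proj₁ G₁⊆G₂
    φ-inj = proj₁ (proj₂ G₁⊆G₂)

    N>0 : 0 < N
    N>0 = >-nonZero⁻¹ N {{nonZeroIndex (copy zero (fromℕ< (proj₁ G₂-conn)))}}

    ∪-monoCopy : ∀ {b} (f : MonoCopy (proj₁ c) b G₁) (g : MonoCopy (proj₁ c) b G₂) →
      (∀ u v → proj₁ f u ≢ proj₁ g v) → MonoCopy (proj₁ c) b (G₁ ∪G G₂)
    ∪-monoCopy = monoCopy-∪ {G₁} {G₂} {c = proj₁ c}

    member : ∀ {b} → Connected (colourGraph c b) → MonoCopy (proj₁ c) b (G₁ ∪G G₂) →
      MonoMember (𝒞 (G₁ ∪G G₂)) c
    member = colourGraph-member {H = G₁ ∪G G₂} {c}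

  bridge : ∀ {b i j} → i ≢ j → colour i ≡ b → colour j ≡ b →
    ∀ u v → proj₁ c (copy i u) (copy j v) ≡ b → MonoMember (𝒞 (G₁ ∪G G₂)) c
  bridge {b} {i} {j} i≢j ci cj u v cuv =
    monoMember-lift {c = c} (proj₁ (proj₂ M)) (colourGraph-member {H = G₁ ∪G G₂} {c′} conn G₁∪G₂-copy)
    where
    M : MonoCopy (proj₁ c) b (G₂ ∪G G₂)
    M = monoCopy-∪ {G₂} {G₂} {c = proj₁ c} (copy-monoCopy i ci) (copy-monoCopy j cj) (copy-disjoint i≢j)
    c′ = restrict c (proj₁ M)
    G₁∪G₂-copy : MonoCopy (proj₁ c′) b (G₁ ∪G G₂)
    G₁∪G₂-copy = monoCopy-⊆ {G₁ ∪G G₂} {G₂ ∪G G₂} {c = proj₁ c′}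
      (∪-mono-⊆ {G₁} {G₂} {G₂} {G₂} G₁⊆G₂ (⊆-refl {G₂})) (monoCopy-restrict {G₂ ∪G G₂} {c = c} M)
    conn : Connected (colourGraph c′ b)
    conn = bridged-connected G₂ G₂ c′ G₂-conn G₂-conn (proj₂ (proj₂ M)) u v
      (trans (cong₂ (proj₁ c) (lookup-++ˡ (copy i) (copy j) u) (lookup-++ʳ (copy i) (copy j) v)) cuv)

  twoCopies : ∀ {b i j} → i ≢ j → colour i ≡ b → colour j ≡ b → MonoCopy (proj₁ c) b (G₁ ∪G G₂)
  twoCopies {i = i} {j} i≢j ci cj =
    ∪-monoCopy (monoCopy-⊆ {G₁} {G₂} {c = proj₁ c} G₁⊆G₂ (copy-monoCopy i ci)) (copy-monoCopy j cj)
      λ u → copy-disjoint i≢j (φ u)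

  oneCopy : ∀ {b i₀} → colour i₀ ≡ b → CrossColoured (punchIn i₀) b → Colorable G₁ (suc q) →
    MonoCopy (proj₁ c) b (G₁ ∪G G₂)
  oneCopy {i₀ = i₀} ci₀ cross κ₁ =
    ∪-monoCopy (spread {H = G₁} (punchIn i₀) cross κ₁ φ φ-inj) (copy-monoCopy i₀ ci₀)
      λ _ _ → copy-disjoint (punchInᵢ≢i i₀ _) _ _

  noCopy : ∀ {b} → CrossColoured id b → Colorable G₂ (suc (suc q)) → MonoCopy (proj₁ c) b (G₁ ∪G G₂)
  noCopy cross κ₂ =
    ∪-monoCopy (spread {H = G₁} id cross κ₁ φ φ-inj) (spread {H = G₂} id cross κ₂ id id) disjoint
    where
    κ₁ = Colorable-map {G₁} cyclicPred cyclicPred-injective (Colorable-⊆ {G₁} {G₂} G₁⊆G₂ κ₂)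
    disjoint : ∀ w v → copy (proj₁ κ₁ w) (φ w) ≢ copy (proj₁ κ₂ v) v
    disjoint w v eq with copy-injective eq
    ... | κ₁w≡κ₂v , refl = cyclicPred-≢ _ κ₁w≡κ₂v

  𝒞∪-member : Colorable G₁ (suc q) → Colorable G₂ (suc (suc q)) → MonoMember (𝒞 (G₁ ∪G G₂)) c
  𝒞∪-member κ₁ κ₂ with colourGraph-connected c N>0
  ... | b , b-conn with any? (λ i → colour i ≟ᵇ b)
  ...   | no ∄i with crossColoured? id b
  ...     | inj₁ cross = member b-conn (noCopy cross κ₂)
  ...     | inj₂ (i , j , i≢j , u , v , cuv) =
            bridge i≢j (¬-not (∄i ∘ (i ,_))) (¬-not (∄i ∘ (j ,_))) u v cuv
  𝒞∪-member κ₁ κ₂ | b , b-conn | yes (i₀ , ci₀) with any? (λ j → colour (punchIn i₀ j) ≟ᵇ b)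
  ...   | yes (j , cj) = member b-conn (twoCopies (punchInᵢ≢i i₀ j) cj ci₀)
  ...   | no ∄j with crossColoured? (punchIn i₀) b
  ...     | inj₁ cross = member b-conn (oneCopy ci₀ cross κ₁)
  ...     | inj₂ (i , j , i≢j , u , v , cuv) =
            bridge (i≢j ∘ punchIn-injective i₀ i j) (¬-not (∄j ∘ (i ,_))) (¬-not (∄j ∘ (j ,_))) u v cuv

arrows-𝒞∪ : ∀ G₁ G₂ {r q} → Arrows r (single G₂) → G₁ ⊆G G₂ → Connected G₂ →
  Colorable G₁ (suc q) → Colorable G₂ (suc (suc q)) → Arrows (r + suc q * ∣V∣ G₂) (𝒞 (G₁ ∪G G₂))
arrows-𝒞∪ G₁ G₂ {q = q} K_r→G₂ G₁⊆G₂ G₂-conn κ₁ κ₂ c =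
  𝒞∪-member G₁ G₂ G₁⊆G₂ G₂-conn c (disjointMonoCopies {G₂} K_r→G₂ (suc q) ≤-refl c) κ₁ κ₂

lemma4p2 : (G₁ G₂ : Graph) → Connected G₁ → Connected G₂ → G₁ ⊆G G₂ →
    (r k₁ k₂ : ℕ) → IsRamsey (single G₂) r →
    IsChromaticNumber G₁ k₁ → IsChromaticNumber G₂ k₂ → 3 ≤ k₂ →
    RamseyLE (𝒞 (G₁ ∪G G₂)) (r + k₂ * ∣V∣ G₂)
    × (k₁ < k₂ → RamseyLE (𝒞 (G₁ ∪G G₂)) (r + (k₂ ∸ 1) * ∣V∣ G₂))
lemma4p2 G₁ G₂ _ G₂-conn G₁⊆G₂ r k₁ (suc (suc k)) (K_r→G₂ , _) (κ₁ , _) (κ₂ , _) (s≤s (s≤s _)) =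
    (_ , ≤-refl , arrows-𝒞∪ G₁ G₂ K_r→G₂ G₁⊆G₂ G₂-conn κ₂∘φ (Colorable-mono {G₂} (n≤1+n _) κ₂))
  , λ k₁<k₂ → _ , ≤-refl , arrows-𝒞∪ G₁ G₂ K_r→G₂ G₁⊆G₂ G₂-conn (Colorable-mono {G₁} (s≤s⁻¹ k₁<k₂) κ₁) κ₂
  where
  κ₂∘φ : Colorable G₁ (suc (suc k))
  κ₂∘φ = Colorable-⊆ {G₁} {G₂} G₁⊆G₂ κ₂
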